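{- Let $T$ be a binary search tree with $n$ nodes whose keys are $1,\dots,n$, and let $x$ be any node. The number of nodes $y$ with $y>x$ whose distance (number of edges on the path) to $x$ in $T$ is at most $\frac{\log_2 n}{2}$ is at most $2\sqrt n-2$. -}

module Defs where

open import Data.Nat using (ℕ; zero; suc; _+_; _*_; _∸_; _^_; _≤?_; _<?_)
open import Data.Nat.Properties using (_≟_)
open import Data.List using (List; []; _∷_; _++_; length; map; upTo)
open import Data.Maybe using (Maybe; just; nothing)
open import Data.Bool using (Bool; true; false; _∧_)
open import Relation.Nullary using (yes; no)
open import Relation.Nullary.Decidable using (⌊_⌋)

data Tree : Set where
  leaf : Tree
  node : Tree → ℕ → Tree → Tree

inorder : Tree → List ℕ
inorder leaf = []
inorder (node l k r) = inorder l ++ (k ∷ inorder r)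

-- T is a binary search tree on n nodes with keys 1,…,n:
-- its in-order key sequence is exactly 1,2,…,n.
IsBSTOn : ℕ → Tree → Set
IsBSTOn n T = inorder T ≡ map suc (upTo n)
  where open import Relation.Binary.PropositionalEquality using (_≡_)

data Dir : Set where
  L R : Dir

-- Path (sequence of left/right moves) from the root to the node with key x
-- (the first such node in pre-order; keys are distinct in a BST).
path : ℕ → Tree → Maybe (List Dir)
path x leaf = nothing
path x (node l k r) with x ≟ k
... | yes _ = just []
... | no _ with path x l
...   | just p = just (L ∷ p)
...   | nothing with path x r
...     | just q = just (R ∷ q)
...     | nothing = nothing

lcp : List Dir → List Dir → ℕ
lcp (L ∷ p) (L ∷ q) = suc (lcp p q)
lcp (R ∷ p) (R ∷ q) = suc (lcp p q)
lcp _ _ = 0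

-- Number of edges on the (unique) path between the nodes with keys x and y:
-- depth x + depth y − 2·depth(lowest common ancestor).
dist : Tree → ℕ → ℕ → Maybe ℕ
dist T x y with path x T | path y T
... | just p | just q = just ((length p ∸ lcp p q) + (length q ∸ lcp p q))
... | _ | _ = nothing

-- y is a node of T, y > x, and dist(x,y) = d with d ≤ (log₂ n)/2,
-- the latter written exactly as 4^d ≤ n.
nearAbove : ℕ → Tree → ℕ → ℕ → Bool
nearAbove n T x y with dist T x y
... | just d = ⌊ x <? y ⌋ ∧ ⌊ 4 ^ d ≤? n ⌋
... | nothing = false

countB : (ℕ → Bool) → List ℕ → ℕ
countB f [] = 0
countB f (a ∷ as) with f a
... | true = suc (countB f as)
... | false = countB f as

nearAboveCount : ℕ → Tree → ℕ → ℕ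
nearAboveCount n T x = countB (nearAbove n T x) (map suc (upTo n))

-- Let D = ⌊log₄ n⌋, so every counted y lies within distance D of x. Such a y is either in the
-- right subtree of x at depth < D there (fewer than 2^D keys), or it is an ancestor a at distance
-- e ≥ 1 from x such that x lies in the left subtree of a, or a key in the right subtree of such an
-- a at depth < D − e there; a and that subtree together hold at most 2^(D−e) keys, and none are
-- counted when e > D. Hence at most 2^D − 1 + 2^(D−1) + … + 1 = 2^(D+1) − 2 keys are counted,
-- and (2^(D+1))² = 4·4^D ≤ 4n. Walking from the root down to x, the induction keeps the invariant
-- (keys counted so far) + 2^(D ∸ depth of x) < 2^(D+1).
module Submission where

open import Defs
open import Data.Bool.Base using (Bool; true; false)
open import Data.Bool.Properties using (T-≡; T-∧; ¬-not)
open import Data.List.Base using (List; []; _∷_; _++_; length; map; upTo)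
open import Data.List.Membership.Propositional using (_∈_)
open import Data.List.Membership.Propositional.Properties using (∈-map⁺; ∈-upTo⁺)
open import Data.List.Relation.Unary.All as All using (All; []; _∷_)
import Data.List.Relation.Unary.All.Properties as Allₚ
open import Data.List.Relation.Unary.AllPairs using (AllPairs; []; _∷_)
import Data.List.Relation.Unary.AllPairs.Properties as AllPairsₚ
open import Data.List.Relation.Unary.Any using (here; there)
import Data.List.Relation.Unary.Any.Properties as Anyₚ
open import Data.Maybe.Base using (Maybe; just; nothing)
open import Data.Nat.Base
open import Data.Nat.Properties
open import Data.Product.Base using (∃; _×_; _,_; proj₁; proj₂)
open import Data.Sum.Base using (inj₁; inj₂)
open import Function.Base using (id; _∘_)
open import Function.Bundles using (Equivalence)
open import Relation.Nullary.Decidable using (yes; no; ⌊_⌋; toWitness)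
open import Relation.Nullary.Negation using (contradiction)
open import Relation.Binary.PropositionalEquality

bit : Bool → ℕ
bit true  = 1
bit false = 0

bit≤1 : ∀ b → bit b ≤ 1
bit≤1 true  = ≤-refl
bit≤1 false = z≤n

countB-∷ : ∀ f a as → countB f (a ∷ as) ≡ bit (f a) + countB f as
countB-∷ f a as with f a
... | true  = refl
... | false = refl

countB-++ : ∀ f xs ys → countB f (xs ++ ys) ≡ countB f xs + countB f ys
countB-++ f []       ys = refl
countB-++ f (a ∷ xs) ys with f a
... | true  = cong suc (countB-++ f xs ys)
... | false = countB-++ f xs ys

countB-none : ∀ f {xs} → All (λ y → f y ≢ true) xs → countB f xs ≡ 0
countB-none f []                  = refl
countB-none f {a ∷ _} (¬fa ∷ ¬fs) with f a
... | true  = contradiction refl ¬fa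
... | false = countB-none f ¬fs

countB-node : ∀ f l k r →
  countB f (inorder (node l k r)) ≡ countB f (inorder l) + (bit (f k) + countB f (inorder r))
countB-node f l k r =
  trans (countB-++ f (inorder l) _) (cong (countB f (inorder l) +_) (countB-∷ f k (inorder r)))

selected-zipWith : ∀ {P Q R : ℕ → Set} (f : ℕ → Bool) {xs} → (∀ {y} → P y → Q y → R y) →
  All P xs → All (λ y → f y ≡ true → Q y) xs → All (λ y → f y ≡ true → R y) xs
selected-zipWith f g []       []       = []
selected-zipWith f g (p ∷ ps) (q ∷ qs) = g p ∘ q ∷ selected-zipWith f g ps qs

data PathView (y : ℕ) (l : Tree) (k : ℕ) (r : Tree) : Maybe (List Dir) → Set where
  at-root  : y ≡ k → PathView y l k r (just [])
  in-left  : ∀ {p} → path y l ≡ just p → PathView y l k r (just (L ∷ p))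
  in-right : ∀ {p} → path y r ≡ just p → PathView y l k r (just (R ∷ p))
  absent   : y ≢ k → path y l ≡ nothing → path y r ≡ nothing → PathView y l k r nothing

path-view : ∀ y l k r → PathView y l k r (path y (node l k r))
path-view y l k r with y ≟ k
... | yes y≡k = at-root y≡k
... | no y≢k with path y l in eqˡ
...   | just p = in-left eqˡ
...   | nothing with path y r in eqʳ
...     | just p  = in-right eqʳ
...     | nothing = absent y≢k eqˡ eqʳ

path-sound : ∀ {y} t {p} → path y t ≡ just p → y ∈ inorder t
path-sound leaf         ()
path-sound {y} (node l k r) eq with path y (node l k r) | path-view y l k r
path-sound (node l k r) refl | _ | at-root refl = Anyₚ.++⁺ʳ (inorder l) (here refl)
path-sound (node l k r) refl | _ | in-left e    = Anyₚ.++⁺ˡ (path-sound l e)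
path-sound (node l k r) refl | _ | in-right e   = Anyₚ.++⁺ʳ (inorder l) (there (path-sound r e))

path-complete : ∀ {y} t → y ∈ inorder t → ∃ λ p → path y t ≡ just p
path-complete leaf         ()
path-complete {y} (node l k r) y∈t with path y (node l k r) | path-view y l k r
... | just p  | _ = p , refl
... | nothing | absent y≢k eqˡ eqʳ with Anyₚ.++⁻ (inorder l) y∈t
...   | inj₁ y∈l         = contradiction (trans (sym eqˡ) (proj₂ (path-complete l y∈l))) λ ()
...   | inj₂ (here y≡k)  = contradiction y≡k y≢k
...   | inj₂ (there y∈r) = contradiction (trans (sym eqʳ) (proj₂ (path-complete r y∈r))) λ ()

data BST : Tree → Set where
  leaf : BST leaf
  node : ∀ {l k r} → All (_< k) (inorder l) → All (k <_) (inorder r) →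
         BST l → BST r → BST (node l k r)

AllPairs-++⁻ : ∀ {R : ℕ → ℕ → Set} xs {ys} → AllPairs R (xs ++ ys) →
  AllPairs R xs × AllPairs R ys × All (λ x → All (R x) ys) xs
AllPairs-++⁻ []       rs         = [] , rs , []
AllPairs-++⁻ (x ∷ xs) (rx ∷ rs) with AllPairs-++⁻ xs rs
... | rxs , rys , rxys = Allₚ.++⁻ˡ xs rx ∷ rxs , rys , Allₚ.++⁻ʳ xs rx ∷ rxys

sorted⇒BST : ∀ t → AllPairs _<_ (inorder t) → BST t
sorted⇒BST leaf         _ = leaf
sorted⇒BST (node l k r) s with AllPairs-++⁻ (inorder l) s
... | sˡ , k<r ∷ sʳ , l<k = node (All.map All.head l<k) k<r (sorted⇒BST l sˡ) (sorted⇒BST r sʳ)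

data Position (l : Tree) (k : ℕ) (r : Tree) (y : ℕ) : List Dir → Set where
  root  : y ≡ k → Position l k r y []
  left  : ∀ {p} → y < k → path y l ≡ just p → Position l k r y (L ∷ p)
  right : ∀ {p} → k < y → path y r ≡ just p → Position l k r y (R ∷ p)

position : ∀ {l k r p} y → BST (node l k r) → path y (node l k r) ≡ just p → Position l k r y p
position {l} {k} {r} y bst eq with path y (node l k r) | path-view y l k r
position         y _                refl | _ | at-root y≡k = root y≡k
position {l}     y (node l<k _ _ _) refl | _ | in-left e   = left (All.lookup l<k (path-sound l e)) e
position {r = r} y (node _ k<r _ _) refl | _ | in-right e  = right (All.lookup k<r (path-sound r e)) e

record Located (t : Tree) (P : List Dir → Set) (y : ℕ) : Set where
  constructor located
  field
    {address} : List Dir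
    path≡     : path y t ≡ just address
    satisfies : P address

located-map : ∀ {t P Q y} → (∀ {p} → P p → Q p) → Located t P y → Located t Q y
located-map f (located e Pp) = located e (f Pp)

located-root : ∀ {l k r P} → BST (node l k r) → Located (node l k r) P k → P []
located-root {k = k} bst (located e Pp) with position k bst e
... | root _      = Pp
... | left k<k _  = contradiction k<k (<-irrefl refl)
... | right k<k _ = contradiction k<k (<-irrefl refl)

locatedˡ : ∀ {l k r P y} → BST (node l k r) → y < k →
  Located (node l k r) P y → Located l (P ∘ (L ∷_)) y
locatedˡ {y = y} bst y<k (located e Pp) with position y bst e
... | root y≡k    = contradiction y≡k (<⇒≢ y<k)
... | left _ e′   = located e′ Pp
... | right k<y _ = contradiction k<y (<-asym y<k)

locatedʳ : ∀ {l k r P y} → BST (node l k r) → k < y →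
  Located (node l k r) P y → Located r (P ∘ (R ∷_)) y
locatedʳ {y = y} bst k<y (located e Pp) with position y bst e
... | root y≡k    = contradiction (sym y≡k) (<⇒≢ k<y)
... | left y<k _  = contradiction y<k (<-asym k<y)
... | right _ e′  = located e′ Pp

2^[1+m]≡2^m+2^m : ∀ m → 2 ^ suc m ≡ 2 ^ m + 2 ^ m
2^[1+m]≡2^m+2^m m = cong (2 ^ m +_) (+-identityʳ (2 ^ m))

countB<2^depth : ∀ {t} m f → BST t →
  All (λ y → f y ≡ true → Located t (λ p → length p < m) y) (inorder t) →
  countB f (inorder t) < 2 ^ m
countB<2^depth {leaf}       m       f _ _ = m^n>0 2 m
countB<2^depth {node l k r} zero    f _ h
  rewrite countB-none f (All.map (λ h′ fy → n≮0 (Located.satisfies (h′ fy))) h) = z<s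
countB<2^depth {node l k r} (suc m) f bst@(node l<k k<r bstˡ bstʳ) h
  with hˡ , _ ∷ hʳ ← Allₚ.++⁻ (inorder l) h = begin-strict
    countB f (inorder (node l k r))     ≡⟨ countB-node f l k r ⟩
    cˡ + (bit (f k) + cʳ)               ≤⟨ +-monoʳ-≤ cˡ (+-monoˡ-≤ cʳ (bit≤1 (f k))) ⟩
    cˡ + suc cʳ                         ≡⟨ +-suc cˡ cʳ ⟩
    suc cˡ + cʳ                         <⟨ +-mono-≤-< cˡ<2^m cʳ<2^m ⟩
    2 ^ m + 2 ^ m                       ≡⟨ 2^[1+m]≡2^m+2^m m ⟨
    2 ^ suc m                           ∎
  where
  open ≤-Reasoning
  cˡ = countB f (inorder l)
  cʳ = countB f (inorder r)
  cˡ<2^m : cˡ < 2 ^ m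
  cˡ<2^m = countB<2^depth m f bstˡ
    (selected-zipWith f (λ y<k → located-map s<s⁻¹ ∘ locatedˡ bst y<k) l<k hˡ)
  cʳ<2^m : cʳ < 2 ^ m
  cʳ<2^m = countB<2^depth m f bstʳ
    (selected-zipWith f (λ k<y → located-map s<s⁻¹ ∘ locatedʳ bst k<y) k<r hʳ)

countB-node-right : ∀ {l k r x} f → k ≤ x → BST (node l k r) →
  All (λ y → f y ≡ true → x < y) (inorder (node l k r)) →
  countB f (inorder (node l k r)) ≡ countB f (inorder r)
countB-node-right {l} {k} {r} f k≤x (node l<k _ _ _) h
  with hˡ , hᵏ ∷ _ ← Allₚ.++⁻ (inorder l) h = begin
    countB f (inorder (node l k r))                      ≡⟨ countB-node f l k r ⟩
    countB f (inorder l) + (bit (f k) + countB f (inorder r))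
      ≡⟨ cong₂ (λ a b → a + (b + countB f (inorder r))) ignoredˡ (cong bit (¬-not ignoredᵏ)) ⟩
    countB f (inorder r)                                 ∎
  where
  open ≡-Reasoning
  ignoredˡ : countB f (inorder l) ≡ 0
  ignoredˡ = countB-none f (All.zipWith (λ (y<k , hy) fy → <-asym (<-≤-trans y<k k≤x) (hy fy)) (l<k , hˡ))
  ignoredᵏ : f k ≢ true
  ignoredᵏ fk = <⇒≱ (hᵏ fk) k≤x

ancestor-bound : ∀ D e b c → (b ≡ true → e < D) → c < 2 ^ (D ∸ suc e) →
  bit b + c + 2 ^ (D ∸ suc e) ≤ 2 ^ (D ∸ e)
ancestor-bound zero    e       true  c e<0 _ = contradiction (e<0 refl) n≮0
ancestor-bound zero    e       false c _ c<1 rewrite n<1⇒n≡0 c<1 | 0∸n≡0 e = ≤-refl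
ancestor-bound (suc D) zero    b     c _ c<2^D = begin
  bit b + c + 2 ^ D     ≤⟨ +-monoˡ-≤ (2 ^ D) (+-monoˡ-≤ c (bit≤1 b)) ⟩
  suc c + 2 ^ D         ≤⟨ +-monoˡ-≤ (2 ^ D) c<2^D ⟩
  2 ^ D + 2 ^ D         ≡⟨ 2^[1+m]≡2^m+2^m D ⟨
  2 ^ suc D             ∎
  where open ≤-Reasoning
ancestor-bound (suc D) (suc e) b     c e<D c<2^D = ancestor-bound D e b c (s<s⁻¹ ∘ e<D) c<2^D

pathDist : List Dir → List Dir → ℕ
pathDist p q = (length p ∸ lcp p q) + (length q ∸ lcp p q)

NearAbove : ℕ → ℕ → List Dir → Tree → ℕ → Set
NearAbove D x p t y = x < y × Located t (λ q → pathDist p q ≤ D) y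

-- pathDist (d ∷ p) (d ∷ q) reduces to pathDist p q, so the hypothesis passes unchanged to the
-- subtree containing x.
countB-nearAbove : ∀ {t x p} D f → BST t → path x t ≡ just p →
  All (λ y → f y ≡ true → NearAbove D x p t y) (inorder t) →
  countB f (inorder t) + 2 ^ (D ∸ length p) < 2 ^ suc D
countB-nearAbove {leaf} _ _ _ () _
countB-nearAbove {node l k r} {x} D f bst@(node l<k k<r bstˡ bstʳ) x∈t near
  with position x bst x∈t | Allₚ.++⁻ (inorder l) near
... | root refl | _ , _ ∷ nearʳ
  rewrite countB-node-right f ≤-refl bst (All.map (proj₁ ∘_) near) = begin-strict
    cʳ + 2 ^ D      <⟨ +-monoˡ-< (2 ^ D) cʳ<2^D ⟩
    2 ^ D + 2 ^ D   ≡⟨ 2^[1+m]≡2^m+2^m D ⟨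
    2 ^ suc D       ∎
  where
  open ≤-Reasoning
  cʳ = countB f (inorder r)
  cʳ<2^D : cʳ < 2 ^ D
  cʳ<2^D = countB<2^depth D f bstʳ
    (selected-zipWith f (λ k<y → locatedʳ bst k<y ∘ proj₂) k<r nearʳ)
... | left {p} x<k x∈l | nearˡ , nearᵏ ∷ nearʳ
  rewrite countB-node f l k r = begin-strict
    cˡ + (bit (f k) + cʳ) + 2 ^ (D ∸ suc e)    ≡⟨ +-assoc cˡ _ _ ⟩
    cˡ + (bit (f k) + cʳ + 2 ^ (D ∸ suc e))    ≤⟨ +-monoʳ-≤ cˡ ancestor ⟩
    cˡ + 2 ^ (D ∸ e)                           <⟨ countB-nearAbove D f bstˡ x∈l nearˡ′ ⟩
    2 ^ suc D                                  ∎
  where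
  open ≤-Reasoning
  e = length p
  cˡ = countB f (inorder l)
  cʳ = countB f (inorder r)
  nearˡ′ : All (λ y → f y ≡ true → NearAbove D x p l y) (inorder l)
  nearˡ′ = selected-zipWith f (λ y<k (x<y , loc) → x<y , locatedˡ bst y<k loc) l<k nearˡ
  selectedᵏ⇒e<D : f k ≡ true → e < D
  selectedᵏ⇒e<D fk = m+n≤o⇒m≤o (suc e) (located-root bst (proj₂ (nearᵏ fk)))
  cʳ<2^[D∸1+e] : cʳ < 2 ^ (D ∸ suc e)
  cʳ<2^[D∸1+e] = countB<2^depth (D ∸ suc e) f bstʳ (selected-zipWith f
    (λ k<y → located-map (λ {q} → depth<budget q) ∘ locatedʳ bst k<y ∘ proj₂) k<r nearʳ)
    where
    depth<budget : ∀ q → pathDist (L ∷ p) (R ∷ q) ≤ D → length q < D ∸ suc e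
    depth<budget q d≤D = m+n≤o⇒m≤o∸n (suc (length q)) (subst (_≤ D) (+-comm (suc e) _) d≤D)
  ancestor : bit (f k) + cʳ + 2 ^ (D ∸ suc e) ≤ 2 ^ (D ∸ e)
  ancestor = ancestor-bound D e (f k) cʳ selectedᵏ⇒e<D cʳ<2^[D∸1+e]
... | right {p} k<x x∈r | _ , _ ∷ nearʳ
  rewrite countB-node-right f (<⇒≤ k<x) bst (All.map (proj₁ ∘_) near) = begin-strict
    cʳ + 2 ^ (D ∸ suc e)  ≤⟨ +-monoʳ-≤ cʳ (^-monoʳ-≤ 2 (∸-monoʳ-≤ D (n≤1+n e))) ⟩
    cʳ + 2 ^ (D ∸ e)      <⟨ countB-nearAbove D f bstʳ x∈r nearʳ′ ⟩
    2 ^ suc D             ∎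
  where
  open ≤-Reasoning
  e = length p
  cʳ = countB f (inorder r)
  nearʳ′ : All (λ y → f y ≡ true → NearAbove D x p r y) (inorder r)
  nearʳ′ = selected-zipWith f (λ k<y (x<y , loc) → x<y , locatedʳ bst k<y loc) k<r nearʳ

nearAbove-sound : ∀ {n t x y p} → path x t ≡ just p → nearAbove n t x y ≡ true →
  x < y × Located t (λ q → 4 ^ pathDist p q ≤ n) y
nearAbove-sound {n} {t} {x} {y} x∈t sel with path x t | path y t in y∈t
... | just p | just q with refl ← x∈t
  with x<y , 4^d≤n ← Equivalence.to (T-∧ {⌊ x <? y ⌋}) (Equivalence.from T-≡ sel)
  = toWitness x<y , located y∈t (toWitness 4^d≤n)

m^n<m^o⇒n<o : ∀ m .{{_ : NonZero m}} {n o} → m ^ n < m ^ o → n < o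
m^n<m^o⇒n<o m {n} {o} mⁿ<mᵒ with n <? o
... | yes n<o = n<o
... | no  n≮o = contradiction (^-monoʳ-≤ m (≮⇒≥ n≮o)) (<⇒≱ mⁿ<mᵒ)

pow-bracket : ∀ {b} → 1 < b → ∀ n → 1 ≤ n → ∃ λ D → b ^ D ≤ n × n < b ^ suc D
pow-bracket 1<b 1 _ = 0 , ≤-refl , *-monoˡ-≤ 1 1<b
pow-bracket {b} 1<b (suc n@(suc _)) _
  with D , bᴰ≤n , n<bᴰ⁺¹ ← pow-bracket 1<b n z<s with b ^ suc D ≤? suc n
... | yes bᴰ⁺¹≤1+n = suc D , bᴰ⁺¹≤1+n , <-≤-trans (s≤s n<bᴰ⁺¹) (^-monoʳ-< b 1<b (n<1+n (suc D)))
... | no  bᴰ⁺¹≰1+n = D , m≤n⇒m≤1+n bᴰ≤n , ≰⇒> bᴰ⁺¹≰1+n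

[2^m]^2≡4^m : ∀ m → (2 ^ m) ^ 2 ≡ 4 ^ m
[2^m]^2≡4^m m = begin
  (2 ^ m) ^ 2   ≡⟨ ^-*-assoc 2 m 2 ⟩
  2 ^ (m * 2)   ≡⟨ cong (2 ^_) (*-comm m 2) ⟩
  2 ^ (2 * m)   ≡⟨ ^-*-assoc 2 2 m ⟨
  4 ^ m         ∎
  where open ≡-Reasoning

map-suc-upTo-increasing : ∀ n → AllPairs _<_ (map suc (upTo n))
map-suc-upTo-increasing n = AllPairsₚ.map⁺ (AllPairsₚ.applyUpTo⁺₁ id n (λ i<j _ → s<s i<j))

nearAboveCount-bound : ∀ {n} T {x} D → IsBSTOn n T → 1 ≤ x → x ≤ n → n < 4 ^ suc D →
  nearAboveCount n T x + 2 ≤ 2 ^ suc D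
nearAboveCount-bound {n} T {x} D bst (s≤s z≤n) x≤n n<4ᴰ⁺¹
  with p , x∈T ← path-complete T (subst (x ∈_) (sym bst) (∈-map⁺ suc (∈-upTo⁺ x≤n))) = begin
    c + 2                          ≡⟨ +-suc c 1 ⟩
    suc (c + 1)                    ≤⟨ s≤s (+-monoʳ-≤ c (m^n>0 2 (D ∸ length p))) ⟩
    suc (c + 2 ^ (D ∸ length p))   ≤⟨ subst (λ xs → countB f xs + 2 ^ (D ∸ length p) < 2 ^ suc D) bst
                                        (countB-nearAbove D f sorted x∈T near) ⟩
    2 ^ suc D                      ∎
  where
  open ≤-Reasoning
  f = nearAbove n T x
  c = nearAboveCount n T x
  sorted : BST T
  sorted = sorted⇒BST T (subst (AllPairs _<_) (sym bst) (map-suc-upTo-increasing n))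
  near : All (λ y → f y ≡ true → NearAbove D x p T y) (inorder T)
  near = All.tabulate λ _ sel → let x<y , loc = nearAbove-sound x∈T sel in
    x<y , located-map (λ 4ᵈ≤n → s≤s⁻¹ (m^n<m^o⇒n<o 4 (≤-<-trans 4ᵈ≤n n<4ᴰ⁺¹))) loc

lemma9 : (n : ℕ) (T : Tree) → IsBSTOn n T → (x : ℕ) → 1 ≤ x → x ≤ n →
         (nearAboveCount n T x + 2) ^ 2 ≤ 4 * n
lemma9 n T bst x 1≤x x≤n with D , 4ᴰ≤n , n<4ᴰ⁺¹ ← pow-bracket (s≤s (s≤s z≤n)) n (≤-trans 1≤x x≤n) = begin
  (nearAboveCount n T x + 2) ^ 2  ≤⟨ ^-monoˡ-≤ 2 (nearAboveCount-bound T D bst 1≤x x≤n n<4ᴰ⁺¹) ⟩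
  (2 ^ suc D) ^ 2                 ≡⟨ [2^m]^2≡4^m (suc D) ⟩
  4 * 4 ^ D                       ≤⟨ *-monoʳ-≤ 4 4ᴰ≤n ⟩
  4 * n                           ∎
  where open ≤-Reasoning
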